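{- Let $\lambda$ be a partition with at most $s$ parts and let $\nu\in\mathrm{Par}(n,s)$ with $\nu\supseteq\lambda$. Then \[ \sum_{\substack{\alpha\in\mathrm{Comp}(n,s),\\ \alpha\supseteq\lambda,\\ \mathrm{sort}(\alpha)=\nu}} q^{\mathrm{coinv}(\alpha)}=\prod_{i\ge0}\genfrac{[}{]}{0pt}{}{\nu'_i-\lambda'_{i+1}}{\nu'_i-\nu'_{i+1}}_q, \] where $\nu'_0:=s$.
   Context: $\mathrm{Comp}(n,s)$ is the set of tuples $\alpha=(\alpha_1,\dots,\alpha_s)$ of nonnegative integers summing to $n$; $\mathrm{Par}(n,s)$ is the set of partitions of $n$ with at most $s$ parts. For $\alpha$ a composition or partition, $\alpha\supseteq\lambda$ means $\alpha_i\ge\lambda_i$ for all $i\le s$ (with $\lambda_i=0$ beyond its length). $\mathrm{sort}(\alpha)$ is the partition obtained by sorting the entries of $\alpha$ in weakly decreasing order. $\mathrm{coinv}(\alpha)=\#\{(i,j):1\le i<j\le s,\ \alpha_i<\alpha_j\}$. $\nu'$, $\lambda'$ are conjugate partitions, with entries $0$ beyond their lengths. $[m]_q=1+q+\cdots+q^{m-1}$, $[m]_q!=[m]_q\cdots[1]_q$, and $\genfrac{[}{]}{0pt}{}{a}{b}_q=\frac{[a]_q!}{[b]_q![a-b]_q!}$. -}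

module Defs where

open import Data.Nat using (ℕ; zero; suc; _+_; _*_; _∸_; _^_; _≤_; _≤?_; _≟_; _≤ᵇ_; _<ᵇ_; NonZero)
open import Data.Nat.Properties using (m*n≢0)
open import Data.Nat.DivMod using (_/_)
open import Data.Bool using (Bool; true; false; if_then_else_)
open import Data.Fin using (Fin; toℕ)
open import Data.Vec using (Vec; []; _∷_; lookup; countᵇ)
import Data.Vec as V
open import Data.List using (List; []; _∷_; map; concatMap; upTo; filter)
open import Data.Nat.ListAction using (sum; product)
open import Data.Product using (_×_)
open import Relation.Binary.PropositionalEquality using (_≡_)
open import Relation.Nullary.Decidable using (_×-dec_)
open import Relation.Unary using (Decidable)
import Data.Vec.Properties as VP
open import Data.Vec.Relation.Binary.Pointwise.Inductive as PW using (Pointwise)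

qint : ℕ → ℕ → ℕ
qint zero    q = 0
qint (suc m) q = 1 + q * qint m q

qfact : ℕ → ℕ → ℕ
qfact zero    q = 1
qfact (suc m) q = qint (suc m) q * qfact m q

qfact≢0 : ∀ m q → NonZero (qfact m q)
qfact≢0 zero    q = _
qfact≢0 (suc m) q = m*n≢0 (qint (suc m) q) (qfact m q) {{_}} {{qfact≢0 m q}}

-- [a choose b]_q = [a]_q! / ([b]_q! [a-b]_q!)   (used only with b ≤ a;
-- the division is exact in ℕ)
qbinom : ℕ → ℕ → ℕ → ℕ
qbinom a b q = (qfact a q / (qfact b q * qfact (a ∸ b) q))
  {{m*n≢0 (qfact b q) (qfact (a ∸ b) q) {{qfact≢0 b q}} {{qfact≢0 (a ∸ b) q}}}}

-- Compositions and partitions with s entries (partitions padded by zeros)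

IsPartition : ∀ {s} → Vec ℕ s → Set
IsPartition {s} v = ∀ (i j : Fin s) → toℕ i ≤ toℕ j → lookup v j ≤ lookup v i

Comp : ℕ → (s : ℕ) → List (Vec ℕ s)
Comp zero    zero    = [] ∷ []
Comp (suc n) zero    = []
Comp n       (suc s) = concatMap (λ k → map (k ∷_) (Comp (n ∸ k) s)) (upTo (suc n))

_⊇_ : ∀ {s} → Vec ℕ s → Vec ℕ s → Set
α ⊇ μ = Pointwise (λ a l → l ≤ a) α μ

⊇-dec : ∀ {s} (μ : Vec ℕ s) → Decidable (_⊇ μ)
⊇-dec μ α = PW.decidable (λ a l → l ≤? a) α μ

insertDec : ∀ {s} → ℕ → Vec ℕ s → Vec ℕ (suc s)
insertDec x []       = x ∷ []
insertDec x (y ∷ ys) = if y ≤ᵇ x then x ∷ y ∷ ys else y ∷ insertDec x ys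

sort : ∀ {s} → Vec ℕ s → Vec ℕ s
sort []       = []
sort (x ∷ xs) = insertDec x (sort xs)

coinv : ∀ {s} → Vec ℕ s → ℕ
coinv []       = 0
coinv (x ∷ xs) = countᵇ (x <ᵇ_) xs + coinv xs

conj : ∀ {s} → Vec ℕ s → ℕ → ℕ
conj {s} ν zero    = s
conj {s} ν (suc i) = countᵇ (λ x → suc i ≤ᵇ x) ν

lhs : ∀ {s} → ℕ → Vec ℕ s → Vec ℕ s → ℕ → ℕ
lhs {s} n lam ν q =
  sum (map (λ α → q ^ coinv α)
           (filter (λ α → ⊇-dec lam α ×-dec VP.≡-dec _≟_ (sort α) ν) (Comp n s)))

-- product over i ≥ 0; factors with i > n are all [0 choose 0]_q = 1
-- (all parts are ≤ n), so it suffices to take 0 ≤ i ≤ n.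
rhs : ∀ {s} → ℕ → Vec ℕ s → Vec ℕ s → ℕ → ℕ
rhs n lam ν q =
  product (map (λ i → qbinom (conj ν i ∸ conj lam (suc i)) (conj ν i ∸ conj ν (suc i)) q)
               (upTo (suc n)))

-- Write c = ν′ and l = λ′.  Splitting the compositions on the left by their first entry k, the later
-- entries larger than k are exactly the parts of ν larger than k, so the left side satisfies
--   L(λ, ν) = Σ_{λ₁ ≤ k ∈ ν} q^{c_{k+1}} L(λ minus λ₁, ν minus one part k).
-- On the right, removing a part k ≥ λ₁ from ν and the part λ₁ from λ lowers both c_i and l_{i+1} by one
-- for i < λ₁, so those factors do not change.  For i ≥ λ₁ we have l_{i+1} = 0 and the remaining factors
-- multiply to a q-multinomial coefficient; expanding it by the first letter of a word (the q-Pascal rule,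
-- iterated) yields the same recurrence, and induction on the number of parts concludes.

module Submission where

open import Defs
open import Data.Bool using (Bool; true; false; T; if_then_else_; _∧_)
open import Data.Bool.Properties using (T-≡; ∧-zeroʳ)
open import Data.Empty using (⊥-elim)
open import Data.Fin using () renaming (zero to fzero; suc to fsuc)
open import Data.List using (List; []; _∷_; map; concatMap; applyUpTo; upTo; filter; _++_)
open import Data.List.Properties using (map-∘; map-cong; map-++)
open import Data.Nat
open import Data.Nat.DivMod using (_/_; m*n/n≡m)
import Data.Nat.ListAction as List
open import Data.Nat.ListAction.Properties using (sum-++)
open import Data.Nat.Properties
open import Algebra.Properties.CommutativeSemigroup +-commutativeSemigroup using () renaming (x∙yz≈y∙xz to x+[y+z]≡y+[x+z])
open import Algebra.Properties.CommutativeSemigroup *-commutativeSemigroup using () renaming (x∙yz≈y∙xz to x*[y*z]≡y*[x*z])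
open import Data.Nat.Solver using (module +-*-Solver)
open import Data.Product using (_×_; _,_; proj₁; proj₂)
open import Data.Vec using (Vec; []; _∷_; lookup; countᵇ; sum)
open import Data.Vec.Properties using (∷-injectiveˡ; ∷-injectiveʳ)
import Data.Vec.Properties as VP
open import Data.Vec.Relation.Unary.All using (All; []; _∷_)
open import Data.Vec.Relation.Unary.AllPairs using (AllPairs; []; _∷_)
open import Data.Vec.Relation.Binary.Pointwise.Inductive using ([]; _∷_)
open import Function.Base using (_∘_)
open import Function.Bundles using (Equivalence; _⇔_; mk⇔)
open import Relation.Nullary using (¬_; Dec; yes; no; does)
open import Relation.Nullary.Decidable using (_×-dec_; dec-true; dec-false; does-⇔)
open import Relation.Unary using (Decidable)
open import Relation.Binary.PropositionalEquality

open +-*-Solver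

≤⇒≤ᵇ≡true : ∀ {m n} → m ≤ n → (m ≤ᵇ n) ≡ true
≤⇒≤ᵇ≡true {m} {n} = dec-true (m ≤? n)

≰⇒≤ᵇ≡false : ∀ {m n} → ¬ m ≤ n → (m ≤ᵇ n) ≡ false
≰⇒≤ᵇ≡false {m} {n} = dec-false (m ≤? n)

<⇒<ᵇ≡true : ∀ {m n} → m < n → (m <ᵇ n) ≡ true
<⇒<ᵇ≡true {m} {n} = dec-true (m <? n)

≮⇒<ᵇ≡false : ∀ {m n} → ¬ m < n → (m <ᵇ n) ≡ false
≮⇒<ᵇ≡false {m} {n} = dec-false (m <? n)

≤ᵇ-refl : ∀ k → (k ≤ᵇ k) ≡ true
≤ᵇ-refl k = ≤⇒≤ᵇ≡true (≤-refl {k})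

<ᵇ≡true⇒< : ∀ {m n} → (m <ᵇ n) ≡ true → m < n
<ᵇ≡true⇒< {m} {n} e = <ᵇ⇒< m n (Equivalence.from T-≡ e)

≤ᵇ≡true⇒≤ : ∀ {m n} → (m ≤ᵇ n) ≡ true → m ≤ n
≤ᵇ≡true⇒≤ {m} {n} e = ≤ᵇ⇒≤ m n (Equivalence.from T-≡ e)

∧≡true⇒ : ∀ {a b} → a ∧ b ≡ true → a ≡ true × b ≡ true
∧≡true⇒ {true} {true} _ = refl , refl

when : Bool → ℕ → ℕ
when b x = if b then x else 0

when-true : ∀ {b} x → b ≡ true → when b x ≡ x
when-true x refl = refl

when-false : ∀ {b} x → b ≡ false → when b x ≡ 0
when-false x refl = refl

when-cong : ∀ b {x y} → (b ≡ true → x ≡ y) → when b x ≡ when b y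
when-cong true  x≡y = x≡y refl
when-cong false _   = refl

*-when : ∀ a b x → a * when b x ≡ when b (a * x)
*-when a true  x = refl
*-when a false x = *-zeroʳ a

when-* : ∀ b x y → when b x * y ≡ when b (x * y)
when-* true  x y = refl
when-* false x y = refl

-- Gaussian binomial coefficients

module _ (q : ℕ) where

  -- gaussian m r = [m + r choose m]_q, computed by the q-Pascal rule.
  gaussian : ℕ → ℕ → ℕ
  gaussian zero    r       = 1
  gaussian (suc m) zero    = 1
  gaussian (suc m) (suc r) = gaussian (suc m) r + q ^ suc r * gaussian m (suc r)

  gaussian-r0 : ∀ m → gaussian m 0 ≡ 1
  gaussian-r0 zero    = refl
  gaussian-r0 (suc m) = refl

  qint-+ : ∀ a b → qint (a + b) q ≡ qint a q + q ^ a * qint b q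
  qint-+ zero    b = sym (+-identityʳ (qint b q))
  qint-+ (suc a) b = begin
    1 + q * qint (a + b) q                  ≡⟨ cong (λ t → 1 + q * t) (qint-+ a b) ⟩
    1 + q * (qint a q + q ^ a * qint b q)   ≡⟨ solve 4 (λ x y z w → con 1 :+ x :* (y :+ z :* w) := con 1 :+ x :* y :+ (x :* z) :* w)
                                                 refl q (qint a q) (q ^ a) (qint b q) ⟩
    qint (suc a) q + q ^ suc a * qint b q   ∎
    where open ≡-Reasoning

  gaussian-qfact : ∀ m r → gaussian m r * qfact m q * qfact r q ≡ qfact (m + r) q
  gaussian-qfact zero    r = +-identityʳ _
  gaussian-qfact (suc m) zero rewrite +-identityʳ m = trans (*-identityʳ _) (+-identityʳ _)
  gaussian-qfact (suc m) (suc r) = begin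
    (A + Q * B) * (qint (suc m) q * qfact m q) * (qint (suc r) q * qfact r q)
      ≡⟨ solve 7 (λ A B Q Im Fm Ir Fr → (A :+ Q :* B) :* (Im :* Fm) :* (Ir :* Fr)
                     := Ir :* (A :* (Im :* Fm) :* Fr) :+ Q :* Im :* (B :* Fm :* (Ir :* Fr)))
                 refl A B Q (qint (suc m) q) (qfact m q) (qint (suc r) q) (qfact r q) ⟩
    qint (suc r) q * (A * qfact (suc m) q * qfact r q) + Q * qint (suc m) q * (B * qfact m q * qfact (suc r) q)
      ≡⟨ cong₂ (λ x y → qint (suc r) q * x + Q * qint (suc m) q * y) (gaussian-qfact (suc m) r) (gaussian-qfact m (suc r)) ⟩
    qint (suc r) q * F (suc m + r) + Q * qint (suc m) q * F (m + suc r)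
      ≡⟨ cong (λ t → qint (suc r) q * F (suc m + r) + Q * qint (suc m) q * F t) (+-suc m r) ⟩
    qint (suc r) q * F (suc m + r) + Q * qint (suc m) q * F (suc m + r)
      ≡⟨ sym (*-distribʳ-+ (F (suc m + r)) (qint (suc r) q) (Q * qint (suc m) q)) ⟩
    (qint (suc r) q + Q * qint (suc m) q) * F (suc m + r)
      ≡⟨ cong (_* F (suc m + r)) (sym (qint-+ (suc r) (suc m))) ⟩
    qint (suc r + suc m) q * F (suc m + r)
      ≡⟨ cong (λ t → qint t q * F (suc m + r)) (trans (+-comm (suc r) (suc m)) (cong suc (+-suc m r))) ⟩
    F (suc (suc m + r))
      ≡⟨ cong (λ t → F (suc t)) (sym (+-suc m r)) ⟩
    F (suc m + suc r) ∎
    where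
    open ≡-Reasoning
    A = gaussian (suc m) r
    B = gaussian m (suc r)
    Q = q ^ suc r
    F = λ t → qfact t q

  qbinom≡gaussian : ∀ {a b} → b ≤ a → qbinom a b q ≡ gaussian b (a ∸ b)
  qbinom≡gaussian {a} {b} b≤a = begin
    qbinom a b q                               ≡⟨ cong (λ t → (t / d) {{d≢0}}) (sym factorial-form) ⟩
    (gaussian b (a ∸ b) * d / d) {{d≢0}}     ≡⟨ m*n/n≡m (gaussian b (a ∸ b)) d {{d≢0}} ⟩
    gaussian b (a ∸ b)                         ∎
    where
    open ≡-Reasoning
    d = qfact b q * qfact (a ∸ b) q
    d≢0 : NonZero d
    d≢0 = m*n≢0 (qfact b q) (qfact (a ∸ b) q) {{qfact≢0 b q}} {{qfact≢0 (a ∸ b) q}}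
    factorial-form : gaussian b (a ∸ b) * d ≡ qfact a q
    factorial-form = begin
      gaussian b (a ∸ b) * d                                 ≡⟨ sym (*-assoc (gaussian b (a ∸ b)) (qfact b q) (qfact (a ∸ b) q)) ⟩
      gaussian b (a ∸ b) * qfact b q * qfact (a ∸ b) q       ≡⟨ gaussian-qfact b (a ∸ b) ⟩
      qfact (b + (a ∸ b)) q                                  ≡⟨ cong (λ t → qfact t q) (m+[n∸m]≡n b≤a) ⟩
      qfact a q                                              ∎

sumRange : (ℕ → ℕ) → ℕ → ℕ → ℕ
sumRange g j zero    = 0
sumRange g j (suc m) = g j + sumRange g (suc j) m

prodRange : (ℕ → ℕ) → ℕ → ℕ → ℕ
prodRange g j zero    = 1
prodRange g j (suc m) = g j * prodRange g (suc j) m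

_≗[_,+_]_ : (ℕ → ℕ) → ℕ → ℕ → (ℕ → ℕ) → Set
g ≗[ j ,+ m ] h = ∀ k → j ≤ k → k < j + m → g k ≡ h k

private
  ≗-head : ∀ {g h j m} → g ≗[ j ,+ suc m ] h → g j ≡ h j
  ≗-head {j = j} e = e j ≤-refl (m<m+n j z<s)

  ≗-tail : ∀ {g h j m} → g ≗[ j ,+ suc m ] h → g ≗[ suc j ,+ m ] h
  ≗-tail {j = j} {m} e k j<k k<j+m = e k (<⇒≤ j<k) (subst (k <_) (sym (+-suc j m)) k<j+m)

sumRange-cong : ∀ g h j m → g ≗[ j ,+ m ] h → sumRange g j m ≡ sumRange h j m
sumRange-cong g h j zero    e = refl
sumRange-cong g h j (suc m) e = cong₂ _+_ (≗-head e) (sumRange-cong g h (suc j) m (≗-tail e))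

prodRange-cong : ∀ g h j m → g ≗[ j ,+ m ] h → prodRange g j m ≡ prodRange h j m
prodRange-cong g h j zero    e = refl
prodRange-cong g h j (suc m) e = cong₂ _*_ (≗-head e) (prodRange-cong g h (suc j) m (≗-tail e))

sumRange-zeros : ∀ g j m → g ≗[ j ,+ m ] (λ _ → 0) → sumRange g j m ≡ 0
sumRange-zeros g j zero    e = refl
sumRange-zeros g j (suc m) e = cong₂ _+_ (≗-head e) (sumRange-zeros g (suc j) m (≗-tail e))

prodRange-ones : ∀ g j m → g ≗[ j ,+ m ] (λ _ → 1) → prodRange g j m ≡ 1
prodRange-ones g j zero    e = refl
prodRange-ones g j (suc m) e = cong₂ _*_ (≗-head e) (prodRange-ones g (suc j) m (≗-tail e))

sumRange-++ : ∀ g j a b → sumRange g j (a + b) ≡ sumRange g j a + sumRange g (j + a) b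
sumRange-++ g j zero    b = cong (λ t → sumRange g t b) (sym (+-identityʳ j))
sumRange-++ g j (suc a) b rewrite +-suc j a =
  trans (cong (g j +_) (sumRange-++ g (suc j) a b)) (sym (+-assoc (g j) _ _))

prodRange-++ : ∀ g j a b → prodRange g j (a + b) ≡ prodRange g j a * prodRange g (j + a) b
prodRange-++ g j zero    b = trans (cong (λ t → prodRange g t b) (sym (+-identityʳ j))) (sym (+-identityʳ _))
prodRange-++ g j (suc a) b rewrite +-suc j a =
  trans (cong (g j *_) (prodRange-++ g (suc j) a b)) (sym (*-assoc (g j) _ _))

sumRange-*ˡ : ∀ a g j m → sumRange (λ k → a * g k) j m ≡ a * sumRange g j m
sumRange-*ˡ a g j zero    = sym (*-zeroʳ a)
sumRange-*ˡ a g j (suc m) = trans (cong (a * g j +_) (sumRange-*ˡ a g (suc j) m)) (sym (*-distribˡ-+ a (g j) _))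

sumRange-zeros-beyond : ∀ {g j m m'} → m ≤ m' → (∀ k → j + m ≤ k → g k ≡ 0) → sumRange g j m' ≡ sumRange g j m
sumRange-zeros-beyond {g} {j} {m} {m'} m≤m' e = begin
  sumRange g j m'                                    ≡⟨ cong (sumRange g j) (sym (m+[n∸m]≡n m≤m')) ⟩
  sumRange g j (m + (m' ∸ m))                        ≡⟨ sumRange-++ g j m (m' ∸ m) ⟩
  sumRange g j m + sumRange g (j + m) (m' ∸ m)       ≡⟨ cong (sumRange g j m +_) (sumRange-zeros g (j + m) (m' ∸ m) (λ k p _ → e k p)) ⟩
  sumRange g j m + 0                                 ≡⟨ +-identityʳ _ ⟩
  sumRange g j m                                     ∎
  where open ≡-Reasoning

private
  sumRange-shift : ∀ g j m → sumRange g (suc j) m ≡ sumRange (λ i → g (suc i)) j m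
  sumRange-shift g j zero    = refl
  sumRange-shift g j (suc m) = cong (g (suc j) +_) (sumRange-shift g (suc j) m)

  prodRange-shift : ∀ g j m → prodRange g (suc j) m ≡ prodRange (λ i → g (suc i)) j m
  prodRange-shift g j zero    = refl
  prodRange-shift g j (suc m) = cong (g (suc j) *_) (prodRange-shift g (suc j) m)

  sum-applyUpTo : ∀ {A : Set} (g : A → ℕ) (f : ℕ → A) m → List.sum (map g (applyUpTo f m)) ≡ sumRange (λ i → g (f i)) 0 m
  sum-applyUpTo g f zero    = refl
  sum-applyUpTo g f (suc m) =
    cong (g (f 0) +_) (trans (sum-applyUpTo g (λ i → f (suc i)) m) (sym (sumRange-shift (λ i → g (f i)) 0 m)))

  product-applyUpTo : ∀ {A : Set} (g : A → ℕ) (f : ℕ → A) m → List.product (map g (applyUpTo f m)) ≡ prodRange (λ i → g (f i)) 0 m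
  product-applyUpTo g f zero    = refl
  product-applyUpTo g f (suc m) =
    cong (g (f 0) *_) (trans (product-applyUpTo g (λ i → f (suc i)) m) (sym (prodRange-shift (λ i → g (f i)) 0 m)))

sum-upTo : ∀ (g : ℕ → ℕ) m → List.sum (map g (upTo m)) ≡ sumRange g 0 m
sum-upTo g = sum-applyUpTo g (λ i → i)

product-upTo : ∀ (g : ℕ → ℕ) m → List.product (map g (upTo m)) ≡ prodRange g 0 m
product-upTo g = product-applyUpTo g (λ i → i)

Sorted : ∀ {s} → Vec ℕ s → Set
Sorted = AllPairs _≥_

IsPartition⇒Sorted : ∀ {s} (v : Vec ℕ s) → IsPartition v → Sorted v
IsPartition⇒Sorted []      p = []
IsPartition⇒Sorted (x ∷ v) p =
  bounded v (λ i → p fzero (fsuc i) z≤n) ∷ IsPartition⇒Sorted v (λ i j i≤j → p (fsuc i) (fsuc j) (s≤s i≤j))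
  where
  bounded : ∀ {s} (w : Vec ℕ s) → (∀ i → lookup w i ≤ x) → All (x ≥_) w
  bounded []      f = []
  bounded (y ∷ w) f = f fzero ∷ bounded w (λ i → f (fsuc i))

countᵇ-∷ : ∀ {s} p x (v : Vec ℕ s) → countᵇ p (x ∷ v) ≡ when (p x) 1 + countᵇ p v
countᵇ-∷ p x v with p x
... | true  = refl
... | false = refl

countᵇ-insertDec : ∀ {s} p x (v : Vec ℕ s) → countᵇ p (insertDec x v) ≡ countᵇ p (x ∷ v)
countᵇ-insertDec p x []       = refl
countᵇ-insertDec p x (y ∷ ys) with y ≤ᵇ x
... | true  = refl
... | false
  rewrite countᵇ-∷ p y (insertDec x ys) | countᵇ-insertDec p x ys | countᵇ-∷ p x ys
        | countᵇ-∷ p x (y ∷ ys) | countᵇ-∷ p y ys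
  = x+[y+z]≡y+[x+z] (when (p y) 1) (when (p x) 1) (countᵇ p ys)

countᵇ-sort : ∀ {s} p (v : Vec ℕ s) → countᵇ p (sort v) ≡ countᵇ p v
countᵇ-sort p []      = refl
countᵇ-sort p (x ∷ v)
  rewrite countᵇ-insertDec p x (sort v) | countᵇ-∷ p x (sort v) | countᵇ-sort p v | countᵇ-∷ p x v = refl

insertDec-injective : ∀ {s} k (a b : Vec ℕ s) → insertDec k a ≡ insertDec k b → a ≡ b
insertDec-injective k []       []       e = refl
insertDec-injective k (y ∷ ys) (z ∷ zs) e with y ≤ᵇ k in y≤k | z ≤ᵇ k in z≤k
... | true  | true  = ∷-injectiveʳ e
... | false | false = cong₂ _∷_ (∷-injectiveˡ e) (insertDec-injective k ys zs (∷-injectiveʳ e))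
... | true  | false with () ← trans (sym z≤k) (subst (λ t → (t ≤ᵇ k) ≡ true) (∷-injectiveˡ e) (≤ᵇ-refl k))
... | false | true  with () ← trans (sym y≤k) (subst (λ t → (t ≤ᵇ k) ≡ true) (sym (∷-injectiveˡ e)) (≤ᵇ-refl k))

_∈ᵇ_ : ∀ {s} → ℕ → Vec ℕ s → Bool
k ∈ᵇ []       = false
k ∈ᵇ (x ∷ xs) with x ≟ k
... | yes _ = true
... | no  _ = k ∈ᵇ xs

remove : ∀ {s} → ℕ → Vec ℕ (suc s) → Vec ℕ s
remove {zero}  k (x ∷ []) = []
remove {suc s} k (x ∷ xs) with x ≟ k
... | yes _ = xs
... | no  _ = x ∷ remove k xs

∈ᵇ-here : ∀ {s} k (v : Vec ℕ s) → (k ∈ᵇ (k ∷ v)) ≡ true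
∈ᵇ-here k v rewrite ≟-diag {k} refl = refl

∈ᵇ-insertDec : ∀ {s} k (v : Vec ℕ s) → (k ∈ᵇ insertDec k v) ≡ true
∈ᵇ-insertDec k []       = ∈ᵇ-here k []
∈ᵇ-insertDec k (y ∷ ys) with y ≤ᵇ k
... | true  = ∈ᵇ-here k (y ∷ ys)
... | false with y ≟ k
...   | yes _ = refl
...   | no  _ = ∈ᵇ-insertDec k ys

All-∈ᵇ : ∀ {s} {P : ℕ → Set} k (v : Vec ℕ s) → All P v → (k ∈ᵇ v) ≡ true → P k
All-∈ᵇ k (x ∷ v) (px ∷ pv) k∈v with x ≟ k
... | yes refl = px
... | no  _    = All-∈ᵇ k v pv k∈v

All-remove : ∀ {s} {P : ℕ → Set} k (v : Vec ℕ (suc s)) → All P v → All P (remove k v)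
All-remove {zero}  k (x ∷ []) _ = []
All-remove {suc s} k (x ∷ v) (px ∷ pv) with x ≟ k
... | yes _ = pv
... | no  _ = px ∷ All-remove k v pv

Sorted-remove : ∀ {s} k (v : Vec ℕ (suc s)) → Sorted v → Sorted (remove k v)
Sorted-remove {zero}  k (x ∷ []) _ = []
Sorted-remove {suc s} k (x ∷ v) (x≥v ∷ sv) with x ≟ k
... | yes _ = sv
... | no  _ = All-remove k v x≥v ∷ Sorted-remove k v sv

insertDec-remove : ∀ {s} k (v : Vec ℕ (suc s)) → Sorted v → (k ∈ᵇ v) ≡ true → insertDec k (remove k v) ≡ v
insertDec-remove {zero}  k (x ∷ []) _ k∈v with x ≟ k
... | yes refl = refl
... | no  _ with () ← k∈v
insertDec-remove {suc s} k (x ∷ y ∷ ys) ((x≥y ∷ x≥ys) ∷ sv) k∈v with x ≟ k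
... | yes refl rewrite ≤⇒≤ᵇ≡true x≥y = refl
... | no  x≢k  rewrite ≰⇒≤ᵇ≡false {x} {k} (λ x≤k → x≢k (≤-antisym x≤k (All-∈ᵇ k (y ∷ ys) (x≥y ∷ x≥ys) k∈v)))
  = cong (x ∷_) (insertDec-remove k (y ∷ ys) sv k∈v)

sum-remove : ∀ {s} k (v : Vec ℕ (suc s)) → (k ∈ᵇ v) ≡ true → sum (remove k v) + k ≡ sum v
sum-remove {zero}  k (x ∷ []) k∈v with x ≟ k
... | yes refl = sym (+-identityʳ x)
... | no  _ with () ← k∈v
sum-remove {suc s} k (x ∷ v) k∈v with x ≟ k
... | yes refl = +-comm (sum v) x
... | no  _    = trans (+-assoc x _ k) (cong (x +_) (sum-remove k v k∈v))

head≤sum : ∀ {s l} {lam : Vec ℕ s} (v : Vec ℕ (suc s)) → v ⊇ (l ∷ lam) → l ≤ sum v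
head≤sum (x ∷ v) (l≤x ∷ _) = ≤-trans l≤x (m≤m+n x (sum v))

countᵇ-remove : ∀ {s} p k (v : Vec ℕ (suc s)) → (k ∈ᵇ v) ≡ true → countᵇ p (remove k v) + when (p k) 1 ≡ countᵇ p v
countᵇ-remove {zero}  p k (x ∷ []) k∈v with x ≟ k
... | yes refl = sym (trans (countᵇ-∷ p x []) (+-identityʳ _))
... | no  _ with () ← k∈v
countᵇ-remove {suc s} p k (x ∷ v) k∈v with x ≟ k
... | yes refl = trans (+-comm _ (when (p x) 1)) (sym (countᵇ-∷ p x v))
... | no  _ rewrite countᵇ-∷ p x (remove k v) | countᵇ-∷ p x v =
  trans (+-assoc (when (p x) 1) _ _) (cong (when (p x) 1 +_) (countᵇ-remove p k v k∈v))

remove-⊇ : ∀ {s} k (v : Vec ℕ (suc s)) l (lam : Vec ℕ s) →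
  Sorted (l ∷ lam) → v ⊇ (l ∷ lam) → l ≤ k → remove k v ⊇ lam
remove-⊇ {zero}  k (x ∷ []) l [] _ _ _ = []
remove-⊇ {suc s} k (x ∷ v) l (l′ ∷ lam) ((l≥l′ ∷ _) ∷ slam) (l≤x ∷ v⊇lam) l≤k with x ≟ k
... | yes _ = v⊇lam
... | no  _ = ≤-trans l≥l′ l≤x ∷ remove-⊇ k v l′ lam slam v⊇lam (≤-trans l≥l′ l≤k)

-- Conjugate counts

Decreasing : (ℕ → ℕ) → Set
Decreasing c = ∀ i → c (suc i) ≤ c i

Decreasing⇒antitone : ∀ {c} → Decreasing c → ∀ {a b} → a ≤ b → c b ≤ c a
Decreasing⇒antitone {c} dec {a} a≤b with m≤n⇒∃[o]m+o≡n a≤b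
... | (o , refl) = go o
  where
  go : ∀ o → c (a + o) ≤ c a
  go zero    rewrite +-identityʳ a = ≤-refl
  go (suc o) rewrite +-suc a o     = ≤-trans (dec (a + o)) (go o)

parts≥ : ∀ {s} → Vec ℕ s → ℕ → ℕ
parts≥ v i = countᵇ (i ≤ᵇ_) v

conj≗parts≥ : ∀ {s} (v : Vec ℕ s) i → conj v i ≡ parts≥ v i
conj≗parts≥ v       (suc i) = refl
conj≗parts≥ []      zero    = refl
conj≗parts≥ (x ∷ v) zero    = cong suc (conj≗parts≥ v zero)

private
  when-mono : ∀ {a b} → (T a → T b) → when a 1 ≤ when b 1
  when-mono {false}         _ = z≤n
  when-mono {true}  {true}  _ = ≤-refl
  when-mono {true}  {false} f = ⊥-elim (f _)

  countᵇ-mono : ∀ {s} p r (v : Vec ℕ s) → (∀ x → T (p x) → T (r x)) → countᵇ p v ≤ countᵇ r v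
  countᵇ-mono p r []      f = z≤n
  countᵇ-mono p r (x ∷ v) f rewrite countᵇ-∷ p x v | countᵇ-∷ r x v =
    +-mono-≤ (when-mono (f x)) (countᵇ-mono p r v f)

parts≥-decreasing : ∀ {s} (v : Vec ℕ s) → Decreasing (parts≥ v)
parts≥-decreasing v i = countᵇ-mono _ _ v (λ x i<x → ≤⇒≤ᵇ (<⇒≤ (≤ᵇ⇒≤ (suc i) x i<x)))

parts≥-mono-⊇ : ∀ {s} (v lam : Vec ℕ s) → v ⊇ lam → ∀ i → parts≥ lam i ≤ parts≥ v i
parts≥-mono-⊇ []      []        []            i = z≤n
parts≥-mono-⊇ (x ∷ v) (l ∷ lam) (l≤x ∷ v⊇lam) i rewrite countᵇ-∷ (i ≤ᵇ_) x v | countᵇ-∷ (i ≤ᵇ_) l lam =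
  +-mono-≤ (when-mono (λ i≤l → ≤⇒≤ᵇ (≤-trans (≤ᵇ⇒≤ i l i≤l) l≤x))) (parts≥-mono-⊇ v lam v⊇lam i)

parts≥-bounded : ∀ {s} (v : Vec ℕ s) {b i} → All (b ≥_) v → b < i → parts≥ v i ≡ 0
parts≥-bounded []      _           _   = refl
parts≥-bounded (x ∷ v) {b} {i} (x≤b ∷ v≤b) b<i
  rewrite countᵇ-∷ (i ≤ᵇ_) x v | ≰⇒≤ᵇ≡false {i} {x} (<⇒≱ (≤-<-trans x≤b b<i)) = parts≥-bounded v v≤b b<i

parts≥-beyond-sum : ∀ {s} (v : Vec ℕ s) {i} → sum v < i → parts≥ v i ≡ 0
parts≥-beyond-sum []      _ = refl
parts≥-beyond-sum (x ∷ v) {i} p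
  rewrite countᵇ-∷ (i ≤ᵇ_) x v | ≰⇒≤ᵇ≡false {i} {x} (<⇒≱ (≤-<-trans (m≤m+n x (sum v)) p)) =
  parts≥-beyond-sum v (≤-<-trans (m≤n+m (sum v) x) p)

dropPart : ℕ → (ℕ → ℕ) → ℕ → ℕ
dropPart k c i = c i ∸ when (i ≤ᵇ k) 1

parts≥-remove : ∀ {s} k (v : Vec ℕ (suc s)) → (k ∈ᵇ v) ≡ true → ∀ i → parts≥ (remove k v) i ≡ dropPart k (parts≥ v) i
parts≥-remove k v k∈v i = sym (begin
  parts≥ v i ∸ when (i ≤ᵇ k) 1
    ≡⟨ cong (_∸ when (i ≤ᵇ k) 1) (sym (countᵇ-remove (i ≤ᵇ_) k v k∈v)) ⟩
  parts≥ (remove k v) i + when (i ≤ᵇ k) 1 ∸ when (i ≤ᵇ k) 1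
    ≡⟨ m+n∸n≡m (parts≥ (remove k v) i) (when (i ≤ᵇ k) 1) ⟩
  parts≥ (remove k v) i ∎)
  where open ≡-Reasoning

private
  ≢⇒<ᵇ≡≤ᵇ : ∀ {k x} → x ≢ k → (k <ᵇ x) ≡ (k ≤ᵇ x)
  ≢⇒<ᵇ≡≤ᵇ {k} {x} x≢k with k <? x
  ... | yes k<x = trans (<⇒<ᵇ≡true k<x) (sym (≤⇒≤ᵇ≡true (<⇒≤ k<x)))
  ... | no  k≮x = trans (≮⇒<ᵇ≡false k≮x) (sym (≰⇒≤ᵇ≡false (λ k≤x → x≢k (sym (≤-antisym k≤x (≮⇒≥ k≮x))))))

  parts≥-gap : ∀ {s} k (v : Vec ℕ s) → (k ∈ᵇ v) ≡ true → parts≥ v (suc k) < parts≥ v k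
  parts≥-gap k (x ∷ v) k∈v with x ≟ k
  ... | yes refl
    rewrite countᵇ-∷ (suc x ≤ᵇ_) x v | countᵇ-∷ (x ≤ᵇ_) x v | ≮⇒<ᵇ≡false (n≮n x) | ≤ᵇ-refl x
    = s≤s (parts≥-decreasing v x)
  ... | no  x≢k
    rewrite countᵇ-∷ (suc k ≤ᵇ_) x v | countᵇ-∷ (k ≤ᵇ_) x v | ≢⇒<ᵇ≡≤ᵇ x≢k
    = +-monoʳ-< (when (k ≤ᵇ x) 1) (parts≥-gap k v k∈v)

  parts≥-no-gap : ∀ {s} k (v : Vec ℕ s) → (k ∈ᵇ v) ≡ false → parts≥ v (suc k) ≡ parts≥ v k
  parts≥-no-gap k []      _ = refl
  parts≥-no-gap k (x ∷ v) k∉v with x ≟ k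
  ... | yes refl with () ← k∉v
  ... | no  x≢k
    rewrite countᵇ-∷ (suc k ≤ᵇ_) x v | countᵇ-∷ (k ≤ᵇ_) x v | ≢⇒<ᵇ≡≤ᵇ x≢k
    = cong (when (k ≤ᵇ x) 1 +_) (parts≥-no-gap k v k∉v)

∈ᵇ≡parts≥-gap : ∀ {s} k (v : Vec ℕ s) → (k ∈ᵇ v) ≡ (parts≥ v (suc k) <ᵇ parts≥ v k)
∈ᵇ≡parts≥-gap k v with k ∈ᵇ v in k∈v
... | true  = sym (<⇒<ᵇ≡true (parts≥-gap k v k∈v))
... | false = sym (≮⇒<ᵇ≡false (λ gap → <-irrefl (parts≥-no-gap k v k∈v) gap))

dropPart-≤ : ∀ {k} c {i} → i ≤ k → dropPart k c i ≡ c i ∸ 1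
dropPart-≤ c {i} i≤k = cong (λ b → c i ∸ when b 1) (≤⇒≤ᵇ≡true i≤k)

dropPart-> : ∀ {k} c {i} → k < i → dropPart k c i ≡ c i
dropPart-> c {i} k<i = cong (λ b → c i ∸ when b 1) (≰⇒≤ᵇ≡false (<⇒≱ k<i))

dropPart-zero : ∀ {k} c {i} → c i ≡ 0 → dropPart k c i ≡ 0
dropPart-zero {k} c {i} cᵢ≡0 = n≤0⇒n≡0 (subst (dropPart k c i ≤_) cᵢ≡0 (m∸n≤m (c i) (when (i ≤ᵇ k) 1)))

dropPart-decreasing : ∀ {k c} → Decreasing c → c (suc k) < c k → Decreasing (dropPart k c)
dropPart-decreasing {k} {c} dec gap i with i ≤? k | suc i ≤? k
... | yes i≤k | yes i<k rewrite dropPart-≤ c i≤k | dropPart-≤ c i<k = ∸-monoˡ-≤ 1 (dec i)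
... | yes i≤k | no  i≮k rewrite dropPart-≤ c i≤k | dropPart-> c (≰⇒> i≮k) | ≤-antisym i≤k (≤-pred (≰⇒> i≮k)) =
  ≤-pred (subst (c (suc k) <_) (sym (suc-pred (c k) {{>-nonZero (≤-<-trans z≤n gap)}})) gap)
... | no  i≰k | _       rewrite dropPart-> c (≰⇒> i≰k) | dropPart-> c (≤-trans (≰⇒> i≰k) (n≤1+n i)) = dec i

-- Expanding a q-multinomial coefficient

private
  ∸-suc-step : ∀ a b {m} → a ∸ b ≡ suc m → a ∸ 1 ∸ b ≡ m
  ∸-suc-step a b {m} a-b = begin
    a ∸ 1 ∸ b     ≡⟨ ∸-+-assoc a 1 b ⟩
    a ∸ (1 + b)   ≡⟨ cong (a ∸_) (+-comm 1 b) ⟩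
    a ∸ (b + 1)   ≡⟨ sym (∸-+-assoc a b 1) ⟩
    a ∸ b ∸ 1     ≡⟨ cong (_∸ 1) a-b ⟩
    m             ∎
    where open ≡-Reasoning

module _ (q : ℕ) where

  gaussian-pascal : ∀ a r → gaussian q (a ∸ suc r) (suc r) ≡
    gaussian q (a ∸ suc r) r + when (suc r <ᵇ a) (q ^ suc r * gaussian q (a ∸ 1 ∸ suc r) (suc r))
  gaussian-pascal a r with a ∸ suc r in a-r
  ... | zero   rewrite ≮⇒<ᵇ≡false {suc r} {a} (≤⇒≯ (m∸n≡0⇒m≤n a-r)) = refl
  ... | suc m₁
    rewrite <⇒<ᵇ≡true {suc r} {a} (m∸n≢0⇒n<m (λ a-r≡0 → 0≢1+n (trans (sym a-r≡0) a-r))) | ∸-suc-step a (suc r) a-r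
    = refl

  gaussianFactor : (ℕ → ℕ) → ℕ → ℕ
  gaussianFactor c i = gaussian q (c i ∸ c (suc i)) (c (suc i))

  -- The product of gaussianFactor c over [j, j + m) counts, with weight q ^ coinv, the words having
  -- c i ∸ c (suc i) letters i; firstLetter c j m k accounts for the words beginning with k, whose
  -- c (suc k) larger letters all follow it.
  firstLetter : (ℕ → ℕ) → ℕ → ℕ → ℕ → ℕ
  firstLetter c j m k = when (c (suc k) <ᵇ c k) (q ^ c (suc k) * prodRange (gaussianFactor (dropPart k c)) j m)

  gaussianFactor-last : ∀ c i → c (suc i) ≡ 0 → gaussianFactor c i ≡ 1
  gaussianFactor-last c i cᵢ₊₁≡0 rewrite cᵢ₊₁≡0 = gaussian-r0 q (c i)

  firstLetter-larger : ∀ {c j r} m → c (suc j) ≡ suc r → ∀ k → suc j ≤ k →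
    firstLetter c j (suc m) k ≡ gaussian q (c j ∸ suc r) r * firstLetter c (suc j) m k
  firstLetter-larger {c} {j} {r} m cⱼ₊₁ k j<k = begin
    when b (q ^ c (suc k) * (gaussianFactor c′ j * P))   ≡⟨ cong (when b) (x*[y*z]≡y*[x*z] (q ^ c (suc k)) (gaussianFactor c′ j) P) ⟩
    when b (gaussianFactor c′ j * (q ^ c (suc k) * P))   ≡⟨ sym (*-when (gaussianFactor c′ j) b _) ⟩
    gaussianFactor c′ j * firstLetter c (suc j) m k       ≡⟨ cong (_* firstLetter c (suc j) m k) dropped-factor ⟩
    gaussian q (c j ∸ suc r) r * firstLetter c (suc j) m k ∎
    where
    open ≡-Reasoning
    b = c (suc k) <ᵇ c k
    c′ = dropPart k c
    P = prodRange (gaussianFactor c′) (suc j) m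
    dropped-factor : gaussianFactor c′ j ≡ gaussian q (c j ∸ suc r) r
    dropped-factor rewrite dropPart-≤ c (<⇒≤ j<k) | dropPart-≤ c j<k | cⱼ₊₁ =
      cong (λ t → gaussian q t r) (∸-+-assoc (c j) 1 r)

  firstLetter-smallest : ∀ {c j r} m → c (suc j) ≡ suc r →
    firstLetter c j (suc m) j ≡
      when (suc r <ᵇ c j) (q ^ suc r * gaussian q (c j ∸ 1 ∸ suc r) (suc r)) * prodRange (gaussianFactor c) (suc j) m
  firstLetter-smallest {c} {j} {r} m cⱼ₊₁ = begin
    when b (q ^ c (suc j) * (gaussianFactor c′ j * prodRange (gaussianFactor c′) (suc j) m))
      ≡⟨ cong₂ (λ x y → when b (q ^ c (suc j) * (x * y))) dropped-factor dropped-rest ⟩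
    when b (q ^ c (suc j) * (G * X))
      ≡⟨ cong (when b) (sym (*-assoc (q ^ c (suc j)) G X)) ⟩
    when b (q ^ c (suc j) * G * X)
      ≡⟨ sym (when-* b (q ^ c (suc j) * G) X) ⟩
    when b (q ^ c (suc j) * G) * X
      ≡⟨ cong (λ t → when (t <ᵇ c j) (q ^ t * G) * X) cⱼ₊₁ ⟩
    when (suc r <ᵇ c j) (q ^ suc r * G) * X ∎
    where
    open ≡-Reasoning
    b = c (suc j) <ᵇ c j
    c′ = dropPart j c
    G = gaussian q (c j ∸ 1 ∸ suc r) (suc r)
    X = prodRange (gaussianFactor c) (suc j) m
    dropped-factor : gaussianFactor c′ j ≡ G
    dropped-factor rewrite dropPart-≤ c (≤-refl {j}) | dropPart-> c (n<1+n j) | cⱼ₊₁ = refl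
    dropped-rest : prodRange (gaussianFactor c′) (suc j) m ≡ X
    dropped-rest = prodRange-cong _ _ (suc j) m (λ i j<i _ →
      cong₂ (λ x y → gaussian q (x ∸ y) y) (dropPart-> c j<i) (dropPart-> c (m<n⇒m<1+n j<i)))

  gaussianFactor-split : ∀ {c j r} m → c (suc j) ≡ suc r →
    gaussianFactor c j * prodRange (gaussianFactor c) (suc j) m ≡
      firstLetter c j (suc m) j + gaussian q (c j ∸ suc r) r * prodRange (gaussianFactor c) (suc j) m
  gaussianFactor-split {c} {j} {r} m cⱼ₊₁ = begin
    gaussianFactor c j * X
      ≡⟨ cong (λ t → gaussian q (c j ∸ t) t * X) cⱼ₊₁ ⟩
    gaussian q (c j ∸ suc r) (suc r) * X
      ≡⟨ cong (_* X) (gaussian-pascal (c j) r) ⟩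
    (gaussian q (c j ∸ suc r) r + W) * X
      ≡⟨ *-distribʳ-+ X (gaussian q (c j ∸ suc r) r) W ⟩
    gaussian q (c j ∸ suc r) r * X + W * X
      ≡⟨ +-comm _ (W * X) ⟩
    W * X + gaussian q (c j ∸ suc r) r * X
      ≡⟨ cong (_+ gaussian q (c j ∸ suc r) r * X) (sym (firstLetter-smallest {c} {j} m cⱼ₊₁)) ⟩
    firstLetter c j (suc m) j + gaussian q (c j ∸ suc r) r * X ∎
    where
    open ≡-Reasoning
    X = prodRange (gaussianFactor c) (suc j) m
    W = when (suc r <ᵇ c j) (q ^ suc r * gaussian q (c j ∸ 1 ∸ suc r) (suc r))

  private
    gaussianProduct-expand-last : ∀ {c} → Decreasing c → ∀ j m → c (suc j) ≡ 0 → 1 ≤ c j →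
      prodRange (gaussianFactor c) j (suc m) ≡ sumRange (firstLetter c j (suc m)) j (suc m)
    gaussianProduct-expand-last {c} dec j m cⱼ₊₁ 1≤cⱼ = begin
      gaussianFactor c j * prodRange (gaussianFactor c) (suc j) m
        ≡⟨ cong₂ _*_ (gaussianFactor-last c j cⱼ₊₁)
                     (prodRange-ones (gaussianFactor c) (suc j) m (λ i j<i _ → gaussianFactor-last c i (zero-after (m≤n⇒m≤1+n j<i)))) ⟩
      1
        ≡⟨ sym (cong₂ _+_ first-term (sumRange-zeros (firstLetter c j (suc m)) (suc j) m (λ k j<k _ → no-later-letter k j<k))) ⟩
      firstLetter c j (suc m) j + sumRange (firstLetter c j (suc m)) (suc j) m ∎
      where
      open ≡-Reasoning
      zero-after : ∀ {k} → suc j ≤ k → c k ≡ 0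
      zero-after {k} j<k = n≤0⇒n≡0 (subst (c k ≤_) cⱼ₊₁ (Decreasing⇒antitone dec j<k))
      no-later-letter : ∀ k → suc j ≤ k → firstLetter c j (suc m) k ≡ 0
      no-later-letter k j<k = when-false _ (≮⇒<ᵇ≡false (λ gap → n≮0 (subst (c (suc k) <_) (zero-after j<k) gap)))
      first-term : firstLetter c j (suc m) j ≡ 1
      first-term = begin
        firstLetter c j (suc m) j
          ≡⟨ when-true _ (<⇒<ᵇ≡true (subst (_< c j) (sym cⱼ₊₁) 1≤cⱼ)) ⟩
        q ^ c (suc j) * prodRange (gaussianFactor (dropPart j c)) j (suc m)
          ≡⟨ cong₂ (λ x y → q ^ x * y) cⱼ₊₁
                   (prodRange-ones (gaussianFactor (dropPart j c)) j (suc m) (λ i j≤i _ →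
                      gaussianFactor-last (dropPart j c) i (dropPart-zero {j} c (zero-after (s≤s j≤i))))) ⟩
        1 ∎

  gaussianProduct-expand : ∀ {c} → Decreasing c → ∀ j m → c (j + m) ≡ 0 → 1 ≤ c j →
    prodRange (gaussianFactor c) j m ≡ sumRange (firstLetter c j m) j m
  gaussianProduct-expand {c} dec j zero    c-end 1≤cⱼ rewrite +-identityʳ j | c-end with () ← 1≤cⱼ
  gaussianProduct-expand {c} dec j (suc m) c-end 1≤cⱼ = by-next-count (c (suc j)) refl
    where
    open ≡-Reasoning
    by-next-count : ∀ x → c (suc j) ≡ x → prodRange (gaussianFactor c) j (suc m) ≡ sumRange (firstLetter c j (suc m)) j (suc m)
    by-next-count zero    cⱼ₊₁ = gaussianProduct-expand-last dec j m cⱼ₊₁ 1≤cⱼ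
    by-next-count (suc r) cⱼ₊₁ = begin
      gaussianFactor c j * X
        ≡⟨ gaussianFactor-split {c} {j} m cⱼ₊₁ ⟩
      firstLetter c j (suc m) j + A * X
        ≡⟨ cong (λ t → firstLetter c j (suc m) j + A * t) ih ⟩
      firstLetter c j (suc m) j + A * sumRange (firstLetter c (suc j) m) (suc j) m
        ≡⟨ cong (firstLetter c j (suc m) j +_) (sym (sumRange-*ˡ A (firstLetter c (suc j) m) (suc j) m)) ⟩
      firstLetter c j (suc m) j + sumRange (λ k → A * firstLetter c (suc j) m k) (suc j) m
        ≡⟨ cong (firstLetter c j (suc m) j +_) (sym (sumRange-cong (firstLetter c j (suc m)) (λ k → A * firstLetter c (suc j) m k)
                                                                   (suc j) m (λ k j<k _ → firstLetter-larger {c} {j} m cⱼ₊₁ k j<k))) ⟩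
      sumRange (firstLetter c j (suc m)) j (suc m) ∎
      where
      X = prodRange (gaussianFactor c) (suc j) m
      A = gaussian q (c j ∸ suc r) r
      ih : X ≡ sumRange (firstLetter c (suc j) m) (suc j) m
      ih = gaussianProduct-expand dec (suc j) m (trans (cong c (sym (+-suc j m))) c-end) (subst (1 ≤_) (sym cⱼ₊₁) (s≤s z≤n))

-- The right-hand side

private
  pred-∸-pred : ∀ a {b} → 1 ≤ b → a ∸ 1 ∸ (b ∸ 1) ≡ a ∸ b
  pred-∸-pred a {suc t} _ = ∸-+-assoc a 1 t

module _ (q : ℕ) where

  binomFactor : (ℕ → ℕ) → (ℕ → ℕ) → ℕ → ℕ
  binomFactor c l i = qbinom (c i ∸ l (suc i)) (c i ∸ c (suc i)) q

  binomFactor-unconstrained : ∀ c l i → l (suc i) ≡ 0 → c (suc i) ≤ c i → binomFactor c l i ≡ gaussianFactor q c i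
  binomFactor-unconstrained c l i lᵢ₊₁≡0 cᵢ₊₁≤cᵢ rewrite lᵢ₊₁≡0 =
    trans (qbinom≡gaussian q (m∸n≤m (c i) (c (suc i)))) (cong (gaussian q (c i ∸ c (suc i))) (m∸[m∸n]≡n cᵢ₊₁≤cᵢ))

  binomFactor-dropPart : ∀ {k} c l l′ i → suc i ≤ k → l (suc i) ≡ suc (l′ (suc i)) → l (suc i) ≤ c (suc i) →
    binomFactor (dropPart k c) l′ i ≡ binomFactor c l i
  binomFactor-dropPart {k} c l l′ i i<k lᵢ₊₁ lᵢ₊₁≤cᵢ₊₁ = cong₂ (λ x y → qbinom x y q) top bottom
    where
    top : dropPart k c i ∸ l′ (suc i) ≡ c i ∸ l (suc i)
    top rewrite dropPart-≤ c (<⇒≤ i<k) | lᵢ₊₁ = ∸-+-assoc (c i) 1 (l′ (suc i))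
    bottom : dropPart k c i ∸ dropPart k c (suc i) ≡ c i ∸ c (suc i)
    bottom rewrite dropPart-≤ c (<⇒≤ i<k) | dropPart-≤ c i<k =
      pred-∸-pred (c i) (≤-trans (subst (1 ≤_) (sym lᵢ₊₁) (s≤s z≤n)) lᵢ₊₁≤cᵢ₊₁)

  binomProduct-dropPart : ∀ {c l l′ L M k} → Decreasing c → c (suc k) < c k → L ≤ k →
    (∀ i → suc i ≤ L → l (suc i) ≡ suc (l′ (suc i))) → (∀ i → L ≤ i → l′ (suc i) ≡ 0) → (∀ i → l (suc i) ≤ c (suc i)) →
    prodRange (binomFactor (dropPart k c) l′) 0 (L + M) ≡ prodRange (binomFactor c l) 0 L * prodRange (gaussianFactor q (dropPart k c)) L M
  binomProduct-dropPart {c} {l} {l′} {L} {M} {k} dec gap L≤k l-below l′-tail l≤c = begin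
    prodRange (binomFactor (dropPart k c) l′) 0 (L + M)
      ≡⟨ prodRange-++ _ 0 L M ⟩
    prodRange (binomFactor (dropPart k c) l′) 0 L * prodRange (binomFactor (dropPart k c) l′) L M
      ≡⟨ cong₂ _*_ (prodRange-cong _ _ 0 L (λ i _ i<L → binomFactor-dropPart c l l′ i (≤-trans i<L L≤k) (l-below i i<L) (l≤c i)))
                   (prodRange-cong _ _ L M (λ i L≤i _ →
                      binomFactor-unconstrained (dropPart k c) l′ i (l′-tail i L≤i) (dropPart-decreasing dec gap i))) ⟩
    prodRange (binomFactor c l) 0 L * prodRange (gaussianFactor q (dropPart k c)) L M ∎
    where open ≡-Reasoning

  -- l and l′ play the conjugates of a partition with first part L and of its remaining parts.
  binomProduct-expand : ∀ {c l l′ L N} → Decreasing c → L ≤ N → c N ≡ 0 → 1 ≤ c L →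
    (∀ i → l (suc i) ≡ when (suc i ≤ᵇ L) 1 + l′ (suc i)) →
    (∀ i → L ≤ i → l′ (suc i) ≡ 0) →
    (∀ i → l (suc i) ≤ c (suc i)) →
    prodRange (binomFactor c l) 0 N ≡
      sumRange (λ k → when ((L ≤ᵇ k) ∧ (c (suc k) <ᵇ c k)) (q ^ c (suc k) * prodRange (binomFactor (dropPart k c) l′) 0 N)) 0 N
  binomProduct-expand {c} {l} {l′} {L} dec L≤N c-end 1≤c[L] l-head l′-tail l≤c with m≤n⇒∃[o]m+o≡n L≤N
  ... | (M , refl) = begin
    prodRange (binomFactor c l) 0 (L + M)
      ≡⟨ prodRange-++ (binomFactor c l) 0 L M ⟩
    A * prodRange (binomFactor c l) L M
      ≡⟨ cong (A *_) (prodRange-cong _ _ L M (λ i L≤i _ → binomFactor-unconstrained c l i (l-tail L≤i) (dec i))) ⟩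
    A * prodRange (gaussianFactor q c) L M
      ≡⟨ cong (A *_) (gaussianProduct-expand q dec L M c-end 1≤c[L]) ⟩
    A * sumRange (firstLetter q c L M) L M
      ≡⟨ sym (sumRange-*ˡ A (firstLetter q c L M) L M) ⟩
    sumRange (λ k → A * firstLetter q c L M k) L M
      ≡⟨ sumRange-cong _ term L M (λ k L≤k _ → term-from L≤k) ⟩
    sumRange term L M
      ≡⟨ cong (_+ sumRange term L M) (sym (sumRange-zeros term 0 L (λ k _ k<L → term-before k<L))) ⟩
    sumRange term 0 L + sumRange term L M
      ≡⟨ sym (sumRange-++ term 0 L M) ⟩
    sumRange term 0 (L + M) ∎
    where
    open ≡-Reasoning
    A = prodRange (binomFactor c l) 0 L
    term = λ k → when ((L ≤ᵇ k) ∧ (c (suc k) <ᵇ c k)) (q ^ c (suc k) * prodRange (binomFactor (dropPart k c) l′) 0 (L + M))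

    l-tail : ∀ {i} → L ≤ i → l (suc i) ≡ 0
    l-tail {i} L≤i = trans (l-head i) (cong₂ _+_ (when-false 1 (≰⇒≤ᵇ≡false (<⇒≱ (s≤s L≤i)))) (l′-tail i L≤i))

    l-below : ∀ {i} → suc i ≤ L → l (suc i) ≡ suc (l′ (suc i))
    l-below {i} i<L = trans (l-head i) (cong (_+ l′ (suc i)) (when-true 1 (≤⇒≤ᵇ≡true i<L)))

    term-before : ∀ {k} → k < L → term k ≡ 0
    term-before {k} k<L = when-false _ (cong (_∧ (c (suc k) <ᵇ c k)) (≰⇒≤ᵇ≡false (<⇒≱ k<L)))

    term-from : ∀ {k} → L ≤ k → A * firstLetter q c L M k ≡ term k
    term-from {k} L≤k = begin
      A * when gap (q ^ c (suc k) * P)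
        ≡⟨ *-when A gap _ ⟩
      when gap (A * (q ^ c (suc k) * P))
        ≡⟨ when-cong gap (λ gap-true → trans (x*[y*z]≡y*[x*z] A (q ^ c (suc k)) P) (cong (q ^ c (suc k) *_) (dropped gap-true))) ⟩
      when gap (q ^ c (suc k) * P′)
        ≡⟨ cong (λ b → when (b ∧ gap) (q ^ c (suc k) * P′)) (sym (≤⇒≤ᵇ≡true L≤k)) ⟩
      term k ∎
      where
      gap = c (suc k) <ᵇ c k
      P = prodRange (gaussianFactor q (dropPart k c)) L M
      P′ = prodRange (binomFactor (dropPart k c) l′) 0 (L + M)
      dropped : gap ≡ true → A * P ≡ P′
      dropped gap-true =
        sym (binomProduct-dropPart {c} {l} {l′} {L} {M} dec (<ᵇ≡true⇒< gap-true) L≤k (λ _ → l-below) l′-tail l≤c)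

-- The left-hand side

module _ {A : Set} where

  sum-map-filter : ∀ {P : A → Set} (P? : Decidable P) (f : A → ℕ) xs →
    List.sum (map f (filter P? xs)) ≡ List.sum (map (λ x → when (does (P? x)) (f x)) xs)
  sum-map-filter P? f []       = refl
  sum-map-filter P? f (x ∷ xs) with does (P? x)
  ... | true  = cong (f x +_) (sum-map-filter P? f xs)
  ... | false = sum-map-filter P? f xs

  sum-map-concatMap : ∀ {B : Set} (h : B → ℕ) (g : A → List B) xs →
    List.sum (map h (concatMap g xs)) ≡ List.sum (map (λ x → List.sum (map h (g x))) xs)
  sum-map-concatMap h g []       = refl
  sum-map-concatMap h g (x ∷ xs) = begin
    List.sum (map h (g x ++ concatMap g xs))                  ≡⟨ cong List.sum (map-++ h (g x) (concatMap g xs)) ⟩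
    List.sum (map h (g x) ++ map h (concatMap g xs))          ≡⟨ sum-++ (map h (g x)) _ ⟩
    List.sum (map h (g x)) + List.sum (map h (concatMap g xs))     ≡⟨ cong (List.sum (map h (g x)) +_) (sum-map-concatMap h g xs) ⟩
    List.sum (map h (g x)) + List.sum (map (λ y → List.sum (map h (g y))) xs) ∎
    where open ≡-Reasoning

  sum-map-*ˡ : ∀ a (f : A → ℕ) xs → List.sum (map (λ x → a * f x) xs) ≡ a * List.sum (map f xs)
  sum-map-*ˡ a f []       = sym (*-zeroʳ a)
  sum-map-*ˡ a f (x ∷ xs) = trans (cong (a * f x +_) (sum-map-*ˡ a f xs)) (sym (*-distribˡ-+ a (f x) _))

  sum-map-when : ∀ b a (f : A → ℕ) xs → List.sum (map (λ x → when b (a * f x)) xs) ≡ when b (a * List.sum (map f xs))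
  sum-map-when true  a f xs = sum-map-*ˡ a f xs
  sum-map-when false a f xs = sum-map-*ˡ 0 f xs

Comp-suc : ∀ n s → Comp n (suc s) ≡ concatMap (λ k → map (k ∷_) (Comp (n ∸ k) s)) (upTo (suc n))
Comp-suc zero    s = refl
Comp-suc (suc n) s = refl

shape? : ∀ {s} (lam ν : Vec ℕ s) → Decidable (λ α → (α ⊇ lam) × (sort α ≡ ν))
shape? lam ν α = ⊇-dec lam α ×-dec VP.≡-dec _≟_ (sort α) ν

parts≥-remove-above : ∀ {s} k (v : Vec ℕ (suc s)) → (k ∈ᵇ v) ≡ true → parts≥ (remove k v) (suc k) ≡ parts≥ v (suc k)
parts≥-remove-above k v k∈v =
  trans (parts≥-remove k v k∈v (suc k)) (cong (λ b → parts≥ v (suc k) ∸ when b 1) (≮⇒<ᵇ≡false (n≮n k)))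

module _ (q : ℕ) where

  weight-∷ : ∀ {s} l₀ (lam : Vec ℕ s) (ν : Vec ℕ (suc s)) → Sorted ν → ∀ k α →
    when (does (shape? (l₀ ∷ lam) ν (k ∷ α))) (q ^ coinv (k ∷ α)) ≡
    when ((l₀ ≤ᵇ k) ∧ (k ∈ᵇ ν)) (q ^ parts≥ ν (suc k) * when (does (shape? lam (remove k ν) α)) (q ^ coinv α))
  weight-∷ l₀ lam ν sν k α with (l₀ ≤ᵇ k) ∧ (k ∈ᵇ ν) in head-ok
  ... | false = when-false _ (dec-false (shape? (l₀ ∷ lam) ν (k ∷ α)) head-bad)
    where
    head-bad : ¬ ((k ∷ α) ⊇ (l₀ ∷ lam) × sort (k ∷ α) ≡ ν)
    head-bad ((l₀≤k ∷ _) , sorted)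
      with () ← trans (sym head-ok)
                      (cong₂ _∧_ (≤⇒≤ᵇ≡true l₀≤k) (subst (λ v → (k ∈ᵇ v) ≡ true) sorted (∈ᵇ-insertDec k (sort α))))
  ... | true = trans (cong (λ b → when b (q ^ coinv (k ∷ α))) (does-⇔ tail-shape (shape? (l₀ ∷ lam) ν (k ∷ α)) (shape? lam σ α)))
                     (weigh (shape? lam σ α))
    where
    σ = remove k ν
    l₀≤k : l₀ ≤ k
    l₀≤k = ≤ᵇ≡true⇒≤ (proj₁ (∧≡true⇒ head-ok))
    k∈ν : (k ∈ᵇ ν) ≡ true
    k∈ν = proj₂ (∧≡true⇒ head-ok)
    reinsert : insertDec k σ ≡ ν
    reinsert = insertDec-remove k ν sν k∈ν
    tail-shape : ((k ∷ α) ⊇ (l₀ ∷ lam) × sort (k ∷ α) ≡ ν) ⇔ (α ⊇ lam × sort α ≡ σ)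
    tail-shape = mk⇔ (λ { ((_ ∷ α⊇lam) , sorted) → α⊇lam , insertDec-injective k (sort α) σ (trans sorted (sym reinsert)) })
                     (λ { (α⊇lam , sorted) → (l₀≤k ∷ α⊇lam) , trans (cong (insertDec k) sorted) reinsert })
    weigh : (d : Dec (α ⊇ lam × sort α ≡ σ)) →
      when (does d) (q ^ coinv (k ∷ α)) ≡ q ^ parts≥ ν (suc k) * when (does d) (q ^ coinv α)
    weigh (no  _)            = sym (*-zeroʳ (q ^ parts≥ ν (suc k)))
    weigh (yes (_ , sorted)) = trans (^-distribˡ-+-* q (parts≥ α (suc k)) (coinv α)) (cong (λ t → q ^ t * q ^ coinv α) larger-parts)
      where
      larger-parts : parts≥ α (suc k) ≡ parts≥ ν (suc k)
      larger-parts = begin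
        parts≥ α (suc k)         ≡⟨ sym (countᵇ-sort (suc k ≤ᵇ_) α) ⟩
        parts≥ (sort α) (suc k)  ≡⟨ cong (λ v → parts≥ v (suc k)) sorted ⟩
        parts≥ σ (suc k)         ≡⟨ parts≥-remove-above k ν k∈ν ⟩
        parts≥ ν (suc k)         ∎
        where open ≡-Reasoning

  lhs-recurrence : ∀ {s} n l₀ (lam : Vec ℕ s) (ν : Vec ℕ (suc s)) → Sorted ν →
    lhs n (l₀ ∷ lam) ν q ≡
      sumRange (λ k → when ((l₀ ≤ᵇ k) ∧ (k ∈ᵇ ν)) (q ^ parts≥ ν (suc k) * lhs (n ∸ k) lam (remove k ν) q)) 0 (suc n)
  lhs-recurrence {s} n l₀ lam ν sν = begin
    lhs n (l₀ ∷ lam) ν q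
      ≡⟨ sum-map-filter (shape? (l₀ ∷ lam) ν) (λ α → q ^ coinv α) (Comp n (suc s)) ⟩
    List.sum (map w (Comp n (suc s)))
      ≡⟨ cong (List.sum ∘ map w) (Comp-suc n s) ⟩
    List.sum (map w (concatMap (λ k → map (k ∷_) (Comp (n ∸ k) s)) (upTo (suc n))))
      ≡⟨ sum-map-concatMap w (λ k → map (k ∷_) (Comp (n ∸ k) s)) (upTo (suc n)) ⟩
    List.sum (map (λ k → List.sum (map w (map (k ∷_) (Comp (n ∸ k) s)))) (upTo (suc n)))
      ≡⟨ sum-upTo _ (suc n) ⟩
    sumRange (λ k → List.sum (map w (map (k ∷_) (Comp (n ∸ k) s)))) 0 (suc n)
      ≡⟨ sumRange-cong _ _ 0 (suc n) (λ k _ _ → first-part k) ⟩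
    sumRange (λ k → when ((l₀ ≤ᵇ k) ∧ (k ∈ᵇ ν)) (q ^ parts≥ ν (suc k) * lhs (n ∸ k) lam (remove k ν) q)) 0 (suc n) ∎
    where
    open ≡-Reasoning
    w : Vec ℕ (suc s) → ℕ
    w α = when (does (shape? (l₀ ∷ lam) ν α)) (q ^ coinv α)
    first-part : ∀ k → List.sum (map w (map (k ∷_) (Comp (n ∸ k) s))) ≡
                       when ((l₀ ≤ᵇ k) ∧ (k ∈ᵇ ν)) (q ^ parts≥ ν (suc k) * lhs (n ∸ k) lam (remove k ν) q)
    first-part k = begin
      List.sum (map w (map (k ∷_) C))
        ≡⟨ cong List.sum (sym (map-∘ C)) ⟩
      List.sum (map (λ α → w (k ∷ α)) C)
        ≡⟨ cong List.sum (map-cong (weight-∷ l₀ lam ν sν k) C) ⟩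
      List.sum (map (λ α → when b (q ^ parts≥ ν (suc k) * w′ α)) C)
        ≡⟨ sum-map-when b (q ^ parts≥ ν (suc k)) w′ C ⟩
      when b (q ^ parts≥ ν (suc k) * List.sum (map w′ C))
        ≡⟨ cong (λ t → when b (q ^ parts≥ ν (suc k) * t)) (sym (sum-map-filter (shape? lam (remove k ν)) (λ α → q ^ coinv α) C)) ⟩
      when b (q ^ parts≥ ν (suc k) * lhs (n ∸ k) lam (remove k ν) q) ∎
      where
      C = Comp (n ∸ k) s
      b = (l₀ ≤ᵇ k) ∧ (k ∈ᵇ ν)
      w′ : Vec ℕ s → ℕ
      w′ α = when (does (shape? lam (remove k ν) α)) (q ^ coinv α)

module _ (q : ℕ) where

  binomProduct : ∀ {s} → ℕ → Vec ℕ s → Vec ℕ s → ℕ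
  binomProduct N lam ν = prodRange (binomFactor q (parts≥ ν) (parts≥ lam)) 0 N

  binomProduct-recurrence : ∀ {s} n l₀ (lam : Vec ℕ s) (ν : Vec ℕ (suc s)) → Sorted (l₀ ∷ lam) → ν ⊇ (l₀ ∷ lam) →
    sum ν ≡ n → ∀ {N} → n < N →
    binomProduct N (l₀ ∷ lam) ν ≡
      sumRange (λ k → when ((l₀ ≤ᵇ k) ∧ (k ∈ᵇ ν)) (q ^ parts≥ ν (suc k) * binomProduct N lam (remove k ν))) 0 (suc n)
  binomProduct-recurrence n l₀ lam ν (l₀≥lam ∷ _) ν⊇lam sν≡n {N} n<N = begin
    binomProduct N (l₀ ∷ lam) ν
      ≡⟨ binomProduct-expand q {c} {parts≥ (l₀ ∷ lam)} {parts≥ lam} {l₀} (parts≥-decreasing ν) l₀≤N (beyond-n n<N) 1≤c[l₀]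
           (λ i → countᵇ-∷ (suc i ≤ᵇ_) l₀ lam) (λ i l₀≤i → parts≥-bounded lam l₀≥lam (s≤s l₀≤i))
           (λ i → parts≥-mono-⊇ ν (l₀ ∷ lam) ν⊇lam (suc i)) ⟩
    sumRange term 0 N
      ≡⟨ sumRange-zeros-beyond n<N (λ k n<k → no-part n<k) ⟩
    sumRange term 0 (suc n)
      ≡⟨ sumRange-cong term _ 0 (suc n) (λ k _ _ → part-removed k) ⟩
    sumRange (λ k → when ((l₀ ≤ᵇ k) ∧ (k ∈ᵇ ν)) (q ^ c (suc k) * binomProduct N lam (remove k ν))) 0 (suc n) ∎
    where
    open ≡-Reasoning
    c = parts≥ ν
    term = λ k → when ((l₀ ≤ᵇ k) ∧ (c (suc k) <ᵇ c k)) (q ^ c (suc k) * prodRange (binomFactor q (dropPart k c) (parts≥ lam)) 0 N)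

    l₀≤N : l₀ ≤ N
    l₀≤N = ≤-trans (subst (l₀ ≤_) sν≡n (head≤sum ν ν⊇lam)) (<⇒≤ n<N)

    beyond-n : ∀ {k} → n < k → c k ≡ 0
    beyond-n n<k = parts≥-beyond-sum ν (subst (_< _) (sym sν≡n) n<k)

    1≤c[l₀] : 1 ≤ c l₀
    1≤c[l₀] = ≤-trans head-counted (parts≥-mono-⊇ ν (l₀ ∷ lam) ν⊇lam l₀)
      where
      head-counted : 1 ≤ parts≥ (l₀ ∷ lam) l₀
      head-counted rewrite ≤ᵇ-refl l₀ = s≤s z≤n

    no-part : ∀ {k} → n < k → term k ≡ 0
    no-part {k} n<k =
      when-false _ (trans (cong ((l₀ ≤ᵇ k) ∧_) (≮⇒<ᵇ≡false (λ gap → n≮0 (subst (c (suc k) <_) (beyond-n n<k) gap))))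
                          (∧-zeroʳ (l₀ ≤ᵇ k)))

    part-removed : ∀ k → term k ≡ when ((l₀ ≤ᵇ k) ∧ (k ∈ᵇ ν)) (q ^ c (suc k) * binomProduct N lam (remove k ν))
    part-removed k = trans (cong (λ b → when ((l₀ ≤ᵇ k) ∧ b) (q ^ c (suc k) * P (dropPart k c))) (sym (∈ᵇ≡parts≥-gap k ν)))
                           (when-cong ((l₀ ≤ᵇ k) ∧ (k ∈ᵇ ν)) (λ ok → cong (q ^ c (suc k) *_) (sym (removed-product (proj₂ (∧≡true⇒ ok))))))
      where
      P : (ℕ → ℕ) → ℕ
      P c′ = prodRange (binomFactor q c′ (parts≥ lam)) 0 N
      removed-product : (k ∈ᵇ ν) ≡ true → P (parts≥ (remove k ν)) ≡ P (dropPart k c)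
      removed-product k∈ν = prodRange-cong _ _ 0 N (λ i _ _ →
        cong₂ (λ x y → qbinom (x ∸ parts≥ lam (suc i)) (x ∸ y) q) (parts≥-remove k ν k∈ν i) (parts≥-remove k ν k∈ν (suc i)))

  lhs≡binomProduct : ∀ {s} n (lam ν : Vec ℕ s) → Sorted lam → Sorted ν → sum ν ≡ n → ν ⊇ lam →
    ∀ {N} → n < N → lhs n lam ν q ≡ binomProduct N lam ν
  lhs≡binomProduct .0 [] [] _ _ refl [] {N} _ = sym (prodRange-ones _ 0 N (λ _ _ _ → refl))
  lhs≡binomProduct n (l₀ ∷ lam) ν slam@(_ ∷ slam′) sν sν≡n ν⊇lam {N} n<N = begin
    lhs n (l₀ ∷ lam) ν q
      ≡⟨ lhs-recurrence q n l₀ lam ν sν ⟩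
    sumRange (λ k → when (b k) (q ^ parts≥ ν (suc k) * lhs (n ∸ k) lam (remove k ν) q)) 0 (suc n)
      ≡⟨ sumRange-cong _ _ 0 (suc n) (λ k _ _ → when-cong (b k) (λ ok → cong (q ^ parts≥ ν (suc k) *_) (removed k ok))) ⟩
    sumRange (λ k → when (b k) (q ^ parts≥ ν (suc k) * binomProduct N lam (remove k ν))) 0 (suc n)
      ≡⟨ sym (binomProduct-recurrence n l₀ lam ν slam ν⊇lam sν≡n n<N) ⟩
    binomProduct N (l₀ ∷ lam) ν ∎
    where
    open ≡-Reasoning
    b = λ k → (l₀ ≤ᵇ k) ∧ (k ∈ᵇ ν)
    removed : ∀ k → b k ≡ true → lhs (n ∸ k) lam (remove k ν) q ≡ binomProduct N lam (remove k ν)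
    removed k ok = lhs≡binomProduct (n ∸ k) lam (remove k ν) slam′ (Sorted-remove k ν sν) sum-removed
                     (remove-⊇ k ν l₀ lam slam ν⊇lam (≤ᵇ≡true⇒≤ (proj₁ (∧≡true⇒ ok)))) (≤-<-trans (m∸n≤m n k) n<N)
      where
      sum-removed : sum (remove k ν) ≡ n ∸ k
      sum-removed = trans (sym (m+n∸n≡m _ k)) (cong (_∸ k) (trans (sum-remove k ν (proj₂ (∧≡true⇒ ok))) sν≡n))

  rhs≡binomProduct : ∀ {s} n (lam ν : Vec ℕ s) → rhs n lam ν q ≡ binomProduct (suc n) lam ν
  rhs≡binomProduct n lam ν =
    trans (product-upTo factor (suc n))
          (prodRange-cong factor _ 0 (suc n) (λ i _ _ →
            cong (λ x → qbinom (x ∸ parts≥ lam (suc i)) (x ∸ parts≥ ν (suc i)) q) (conj≗parts≥ ν i)))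
    where
    factor : ℕ → ℕ
    factor i = qbinom (conj ν i ∸ conj lam (suc i)) (conj ν i ∸ conj ν (suc i)) q

lemma5p1 : (n s : ℕ) (lam ν : Vec ℕ s) →
    IsPartition lam → IsPartition ν → sum ν ≡ n → ν ⊇ lam →
    (q : ℕ) → lhs n lam ν q ≡ rhs n lam ν q
lemma5p1 n s lam ν lam-partition ν-partition sν≡n ν⊇lam q = begin
  lhs n lam ν q
    ≡⟨ lhs≡binomProduct q n lam ν (IsPartition⇒Sorted lam lam-partition) (IsPartition⇒Sorted ν ν-partition)
                        sν≡n ν⊇lam (n<1+n n) ⟩
  binomProduct q (suc n) lam ν
    ≡⟨ sym (rhs≡binomProduct q n lam ν) ⟩
  rhs n lam ν q ∎
  where open ≡-Reasoning
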